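{- If $(\mathbf B_n)_{n\in\mathbb N}$ is a basic sequence of structures in $\mathcal B_{k,\ell}$ and $I$ is a QF-interpretation scheme of $\lambda$-structures in $\beta_{k,\ell}$-structures, then $(I(\mathbf B_n))_{n\in\mathbb N}$ is a strongly polynomial sequence of $\lambda$-structures.
   Context: A signature is a finite set of relation symbols with arities; a $\lambda$-structure has a finite domain and, for each symbol of arity $r$, an $r$-ary relation on the domain. For a first-order formula $\phi$ (with equality) with exactly $p$ free variables, $\phi(\mathbf A)$ is the set of $p$-tuples satisfying $\phi$ in $\mathbf A$; a sequence $(\mathbf A_n)_{n\in\mathbb N}$ is strongly polynomial if for every quantifier-free $\phi$ there is a polynomial $P_\phi$ with $|\phi(\mathbf A_n)|=P_\phi(n)$ for all $n$. Interpretation scheme: if $\lambda$ has symbols $R_1,\dots,R_q$ of arities $r_1,\dots,r_q$, $I=(p,\rho_0,\dots,\rho_q)$ with $\rho_0$ a $\kappa$-formula with $p$ free variables and $\rho_i$ a $\kappa$-formula with $pr_i$ free variables; $I(\mathbf A)$ has domain $\rho_0(\mathbf A)\subseteq A^p$ and $R_i(\mathbf v_1,\dots,\mathbf v_{r_i})$ holds iff $\mathbf A\models\rho_i(\mathbf v_1,\dots,\mathbf v_{r_i})$; QF means all $\rho_i$ are quantifier-free. Strong sum $\mathbf A\oplus\mathbf B$ of a $\kappa$-structure and a $\lambda$-structure: signature $\kappa\sqcup\lambda$, domain $A\sqcup B$, each relation of $\kappa$ (resp. $\lambda$) holding exactly on the tuples of $A$ (resp. $B$) on which it holds in $\mathbf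 A$ (resp. $\mathbf B$). $\mathbf E$: one-element domain with one unary relation $U$ true on it. $\mathbf T_N$: domain $\{1,\dots,N\}$, binary $S$ with $S(i,j)\iff i<j$, unary $U$ true everywhere. A basic structure with parameters $(k,\ell)$ is $\mathbf E\oplus\dots\oplus\mathbf E\oplus\mathbf T_{N_1}\oplus\dots\oplus\mathbf T_{N_k}$ ($\ell$ copies of $\mathbf E$), for some integers $N_1,\dots,N_k$ (denoted $N_i(\mathbf B)$); $\mathcal B_{k,\ell}$ is the class of these and $\beta_{k,\ell}$ their signature, with relations $U^E_1,\dots,U^E_\ell,U^T_1,\dots,U^T_k,S_1,\dots,S_k$. A basic sequence is a sequence $(\mathbf B_n)$ in $\mathcal B_{k,\ell}$ (fixed $k,\ell$) with non-constant polynomials $Q_1,\dots,Q_k$ such that $N_i(\mathbf B_n)=Q_i(n)$ for all $i,n$. -}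

module Defs where

open import Data.Nat as ℕ using (ℕ; zero; suc)
open import Data.Fin as Fin using (Fin; splitAt; remQuot)
open import Data.Fin.Properties using () renaming (_≟_ to _≟ᶠ_; _<?_ to _<?ᶠ_)
open import Data.Bool using (Bool; true; false; not; _∧_; _∨_; if_then_else_)
open import Data.List as List using (List; []; _∷_; length; concatMap; map; lookup)
open import Data.List.Relation.Unary.Any using (Any)
open import Data.Vec.Functional using () renaming (_∷_ to _∷ᵥ_)
open import Data.Sum using (_⊎_; inj₁; inj₂)
open import Data.Product using (Σ; _×_; _,_; proj₁; proj₂)
open import Data.Integer using (+_)
open import Data.Rational as ℚ using (ℚ; 0ℚ; _/_)
open import Relation.Nullary using (¬_; does)
open import Relation.Binary.PropositionalEquality using (_≡_)

record Signature : Set where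
  field
    nsym  : ℕ
    arity : Fin nsym → ℕ
open Signature public

-- The domain is {0,…,size-1} (Fin size); every
-- finite structure is isomorphic to one of this form, and all counts
-- |φ(A)| are isomorphism invariant.
record Structure (σ : Signature) : Set where
  field
    size : ℕ
    rel  : (s : Fin (nsym σ)) → (Fin (arity σ s) → Fin size) → Bool
open Structure public

data QF (σ : Signature) (p : ℕ) : Set where
  tt ff : QF σ p
  ¬'    : QF σ p → QF σ p
  _∧'_  : QF σ p → QF σ p → QF σ p
  _∨'_  : QF σ p → QF σ p → QF σ p
  _≐_   : Fin p → Fin p → QF σ p
  R     : (s : Fin (nsym σ)) → (Fin (arity σ s) → Fin p) → QF σ p

sat : ∀ {σ p} (A : Structure σ) → QF σ p → (Fin p → Fin (size A)) → Bool
sat A tt       v = true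
sat A ff       v = false
sat A (¬' φ)   v = not (sat A φ v)
sat A (φ ∧' ψ) v = sat A φ v ∧ sat A ψ v
sat A (φ ∨' ψ) v = sat A φ v ∨ sat A ψ v
sat A (x ≐ y)  v = does (v x ≟ᶠ v y)
sat A (R s as) v = rel A s (λ j → v (as j))

allTuples : (p m : ℕ) → List (Fin p → Fin m)
allTuples zero    m = (λ ()) ∷ []
allTuples (suc p) m =
  concatMap (λ a → map (λ v → a ∷ᵥ v) (allTuples p m)) (List.allFin m)

filterB : ∀ {X : Set} → (X → Bool) → List X → List X
filterB f []       = []
filterB f (x ∷ xs) = if f x then x ∷ filterB f xs else filterB f xs

solutions : ∀ {σ p} (A : Structure σ) → QF σ p → List (Fin p → Fin (size A))
solutions {p = p} A φ = filterB (sat A φ) (allTuples p (size A))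

count : ∀ {σ p} (A : Structure σ) → QF σ p → ℕ
count A φ = length (solutions A φ)

-- Polynomials with rational coefficients (coefficient list, constant
-- term first) and their evaluation at natural numbers.

Poly : Set
Poly = List ℚ

ℕtoℚ : ℕ → ℚ
ℕtoℚ n = + n / 1

evalPoly : Poly → ℕ → ℚ
evalPoly []       n = 0ℚ
evalPoly (c ∷ cs) n = c ℚ.+ ℕtoℚ n ℚ.* evalPoly cs n

NonConstant : Poly → Set
NonConstant []       = Data.Empty.⊥
  where import Data.Empty
NonConstant (c ∷ cs) = Any (λ d → ¬ (d ≡ 0ℚ)) cs

StronglyPolynomial : ∀ {σ} → (ℕ → Structure σ) → Set
StronglyPolynomial {σ} A =
  (p : ℕ) (φ : QF σ p) →
  Σ Poly λ P → (n : ℕ) → ℕtoℚ (count (A n) φ) ≡ evalPoly P n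

record QFInterpretation (λs κ : Signature) : Set where
  field
    dim  : ℕ
    ρ₀   : QF κ dim
    ρ    : (s : Fin (nsym λs)) → QF κ (arity λs s ℕ.* dim)
open QFInterpretation public

-- Its domain is ρ₀(A) ⊆ A^p, listed (without repetition) as
-- solutions A ρ₀; domain element i stands for the i-th tuple of that
-- list.  R_s(v₁,…,v_r) holds iff A ⊨ ρ_s(v₁,…,v_r), where variable
-- number (j·p + c) of ρ_s is the c-th coordinate of v_j.
interpret : ∀ {λs κ} → QFInterpretation λs κ → Structure κ → Structure λs
interpret {λs} I A = record
  { size = length L
  ; rel  = λ s args →
      sat A (ρ I s) (λ x → let jc = remQuot (dim I) x
                           in lookup L (args (proj₁ jc)) (proj₂ jc))
  }
  where
    L = solutions A (ρ₀ I)

-- Basic structures  E ⊕ … ⊕ E (ℓ copies) ⊕ T_{N₁} ⊕ … ⊕ T_{N_k}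

-- Signature β_{k,ℓ}: symbols are, in order,
--   U^E_1 … U^E_ℓ (unary), U^T_1 … U^T_k (unary), S_1 … S_k (binary).
βarity : ∀ {k ℓ : ℕ} → Fin ℓ ⊎ (Fin k ⊎ Fin k) → ℕ
βarity (inj₁ _)        = 1
βarity (inj₂ (inj₁ _)) = 1
βarity (inj₂ (inj₂ _)) = 2

βsplit : (k ℓ : ℕ) → Fin (ℓ ℕ.+ (k ℕ.+ k)) → Fin ℓ ⊎ (Fin k ⊎ Fin k)
βsplit k ℓ s with splitAt ℓ s
... | inj₁ e = inj₁ e
... | inj₂ t = inj₂ (splitAt k t)

β : (k ℓ : ℕ) → Signature
β k ℓ = record { nsym = ℓ ℕ.+ (k ℕ.+ k) ; arity = λ s → βarity {k} {ℓ} (βsplit k ℓ s) }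

sumN : (k : ℕ) → (Fin k → ℕ) → ℕ
sumN zero    N = 0
sumN (suc k) N = N Fin.zero ℕ.+ sumN k (λ i → N (Fin.suc i))

decodeT : (k : ℕ) (N : Fin k → ℕ) → Fin (sumN k N) → Σ (Fin k) (λ i → Fin (N i))
decodeT (suc k) N x with splitAt (N Fin.zero) x
... | inj₁ j = Fin.zero , j
... | inj₂ y with decodeT k (λ i → N (Fin.suc i)) y
...   | i , j = Fin.suc i , j

decodeB : (k ℓ : ℕ) (N : Fin k → ℕ) → Fin (ℓ ℕ.+ sumN k N) →
          Fin ℓ ⊎ Σ (Fin k) (λ i → Fin (N i))
decodeB k ℓ N x with splitAt ℓ x
... | inj₁ e = inj₁ e
... | inj₂ y = inj₂ (decodeT k N y)

module _ (k ℓ : ℕ) (N : Fin k → ℕ) where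
  private
    D = Fin (ℓ ℕ.+ sumN k N)
    dec = decodeB k ℓ N

  isE : Fin ℓ → D → Bool
  isE e x with dec x
  ... | inj₁ e' = does (e ≟ᶠ e')
  ... | inj₂ _  = false

  inT : Fin k → D → Bool
  inT i x with dec x
  ... | inj₁ _       = false
  ... | inj₂ (i' , _) = does (i ≟ᶠ i')

  lessT : Fin k → D → D → Bool
  lessT i x y with dec x | dec y
  ... | inj₂ (i₁ , j₁) | inj₂ (i₂ , j₂) =
          does (i ≟ᶠ i₁) ∧ does (i ≟ᶠ i₂) ∧ does (Fin.toℕ j₁ ℕ.<? Fin.toℕ j₂)
  ... | _ | _ = false

  βrel : (c : Fin ℓ ⊎ (Fin k ⊎ Fin k)) → (Fin (βarity {k} {ℓ} c) → D) → Bool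
  βrel (inj₁ e)        a = isE e (a Fin.zero)
  βrel (inj₂ (inj₁ i)) a = inT i (a Fin.zero)
  βrel (inj₂ (inj₂ i)) a = lessT i (a Fin.zero) (a (Fin.suc Fin.zero))

  basic : Structure (β k ℓ)
  basic = record { size = ℓ ℕ.+ sumN k N ; rel = λ s → βrel (βsplit k ℓ s) }

IsBasicSequence : (k : ℕ) → (ℕ → Fin k → ℕ) → Set
IsBasicSequence k N =
  Σ (Fin k → Poly) λ Q →
    ((i : Fin k) → NonConstant (Q i)) ×
    ((i : Fin k) (n : ℕ) → ℕtoℚ (N n i) ≡ evalPoly (Q i) n)

module Submission where

-- First, a quantifier-free formula φ about I(A) becomes a quantifier-free formula
-- about A with the same number of solutions: I(A) lists ρ₀(A) without repetition, so tuples of its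
-- elements correspond to tuples of blocks of elements of A satisfying ρ₀.  Second, a basic structure
-- is a linear order coloured by ℓ single points followed by k monochromatic intervals of lengths
-- N₁, …, N_k, and its relations are expressible by colours, equality and the order.  On such coloured
-- orders the number of solutions of a formula is a polynomial in N₁, …, N_k, by induction on the
-- number of free variables: a new least element of colour a adds, for each way of sending some of
-- the variables to it, the solutions of a formula with fewer variables.  So as a function of the
-- length n of the first interval the count has polynomial differences, i.e. it is
-- Σ_r C(n, r) · p_r(N₂, …, N_k).  Substituting N_i = Q_i(n), and using that C(x, r) is a polynomial
-- in x, finishes the proof.

open import Defs
open import Data.Bool using (Bool; true; false; T; not; _∧_; _∨_; if_then_else_)
open import Data.Bool.Properties using (T-∧)
open import Data.Fin using (Fin; zero; suc; toℕ; splitAt; combine; remQuot)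
open import Data.Fin.Properties
  using (remQuot-combine; splitAt⁻¹-↑ˡ; splitAt⁻¹-↑ʳ; toℕ-↑ˡ; toℕ-↑ʳ) renaming (_≟_ to _≟ᶠ_)
import Data.Integer as ℤ
import Data.Integer.Properties as ℤ
open import Data.List using (List; []; _∷_; _++_; map; concatMap; length; lookup; tabulate; allFin; filterᵇ)
open import Data.List.Membership.Propositional.Properties using (∈-lookup)
open import Data.List.Properties using (map-++; map-∘; map-cong; tabulate-lookup)
open import Data.List.Relation.Unary.All as All using (All; []; _∷_)
import Data.List.Relation.Unary.All.Properties as All
open import Data.List.Relation.Unary.AllPairs as AllPairs using (AllPairs; []; _∷_)
import Data.List.Relation.Unary.AllPairs.Properties as AllPairs
open import Data.Maybe as Maybe using (Maybe; just; nothing; maybe)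
open import Data.Nat as ℕ using (ℕ; zero; suc; _+_; _*_; _<_; _≤_; s≤s)
open import Data.Nat.Combinatorics using (_C_; nC1≡n; nCk+nC[k+1]≡[n+1]C[k+1])
open import Data.Nat.Coprimality using (1-coprimeTo) renaming (sym to coprime-sym)
open import Data.Nat.Induction using (<-rec)
open import Data.Nat.ListAction using (sum)
open import Data.Nat.ListAction.Properties using (sum-++)
open import Data.Nat.Properties
  using ( +-*-semiring; +-commutativeSemigroup; +-assoc; +-comm; +-identityʳ; *-assoc; *-zeroʳ
        ; *-identityˡ; *-identityʳ; *-distribˡ-+; *-distribʳ-+; ≤-refl; <⇒≤ )
open import Data.Nat.Tactic.RingSolver using (solve-∀)
open import Data.Product using (Σ; _,_; proj₁; proj₂; uncurry)
open import Data.Rational as ℚ using (ℚ; 0ℚ; 1ℚ; mkℚ; toℚᵘ)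
import Data.Rational.Properties as ℚ
open import Data.Rational.Solver using (module +-*-Solver)
import Data.Rational.Unnormalised as ℚᵘ
import Data.Rational.Unnormalised.Properties as ℚᵘ
open import Data.Sum using (_⊎_; inj₁; inj₂; [_,_]′)
open import Data.Sum.Properties using (≡-dec)
open import Data.Vec.Functional using (replicate) renaming (_∷_ to _∷ᵥ_; _++_ to _++ᵥ_)
open import Data.Vec.Functional.Properties using (lookup-++ˡ; lookup-++ʳ; ++-cong)
open import Function using (_∘_; id; _⇔_; mk⇔; Equivalence)
open import Function.Definitions using (Congruent)
open import Relation.Binary.Definitions using (DecidableEquality)
open import Relation.Binary.PropositionalEquality
open import Relation.Nullary using (¬_; contradiction; Dec; yes; no; does; proof)
open import Relation.Nullary.Decidable using (T?)
open import Relation.Nullary.Reflects using (fromEquivalence; det)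
open import Algebra.Properties.CommutativeSemigroup +-commutativeSemigroup using (interchange; x∙yz≈y∙xz)
open import Algebra.Properties.Semiring.Sum +-*-semiring
  using (sum-syntax; sum-cong-≗; ∑-distrib-+; sum-replicate-zero; *-distribˡ-sum)

private
  variable
    X Y : Set

∑ₗ : List X → (X → ℕ) → ℕ
∑ₗ xs f = sum (map f xs)

infix 5 ∑ₗ
syntax ∑ₗ xs (λ x → e) = ∑[ x ∈ xs ] e

∑ₗ-cong : (xs : List X) {f g : X → ℕ} → f ≗ g → ∑ₗ xs f ≡ ∑ₗ xs g
∑ₗ-cong xs f≗g = cong sum (map-cong f≗g xs)

∑ₗ-++ : (xs ys : List X) (f : X → ℕ) → ∑ₗ (xs ++ ys) f ≡ ∑ₗ xs f + ∑ₗ ys f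
∑ₗ-++ xs ys f = trans (cong sum (map-++ f xs ys)) (sum-++ (map f xs) (map f ys))

∑ₗ-map : (h : X → Y) (xs : List X) (f : Y → ℕ) → ∑ₗ (map h xs) f ≡ ∑ₗ xs (f ∘ h)
∑ₗ-map h xs f = cong sum (sym (map-∘ xs))

∑ₗ-concatMap : (h : X → List Y) (xs : List X) (f : Y → ℕ) →
               ∑ₗ (concatMap h xs) f ≡ ∑[ x ∈ xs ] ∑ₗ (h x) f
∑ₗ-concatMap h []       f = refl
∑ₗ-concatMap h (x ∷ xs) f =
  trans (∑ₗ-++ (h x) (concatMap h xs) f) (cong (∑ₗ (h x) f +_) (∑ₗ-concatMap h xs f))

∑ₗ-tabulate : ∀ {n} (t : Fin n → X) (f : X → ℕ) → ∑ₗ (tabulate t) f ≡ ∑[ i < n ] f (t i)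
∑ₗ-tabulate {n = zero}  t f = refl
∑ₗ-tabulate {n = suc n} t f = cong (f (t zero) +_) (∑ₗ-tabulate (t ∘ suc) f)

∑ₗ-lookup : (xs : List X) (f : X → ℕ) → ∑[ i < length xs ] f (lookup xs i) ≡ ∑ₗ xs f
∑ₗ-lookup xs f =
  trans (sym (∑ₗ-tabulate (lookup xs) f)) (cong (λ ys → ∑ₗ ys f) (tabulate-lookup xs))

∑-∑ₗ-comm : ∀ M (xs : List X) (h : Fin M → X → ℕ) →
            ∑[ a < M ] ∑ₗ xs (h a) ≡ ∑[ x ∈ xs ] ∑[ a < M ] h a x
∑-∑ₗ-comm M []       h = sum-replicate-zero M
∑-∑ₗ-comm M (x ∷ xs) h =
  trans (∑-distrib-+ (λ a → h a x) (λ a → ∑ₗ xs (h a)))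
        (cong ((∑[ a < M ] h a x) +_) (∑-∑ₗ-comm M xs h))

indicator : Bool → ℕ
indicator true  = 1
indicator false = 0

indicator-∧ : ∀ a b → indicator (a ∧ b) ≡ indicator a * indicator b
indicator-∧ true  b = sym (+-identityʳ _)
indicator-∧ false b = refl

length-filterB : (P : X → Bool) (xs : List X) → length (filterB P xs) ≡ ∑[ x ∈ xs ] indicator (P x)
length-filterB P []       = refl
length-filterB P (x ∷ xs) with P x
... | true  = cong suc (length-filterB P xs)
... | false = length-filterB P xs

∑ₗ-filterB : (P : X → Bool) (xs : List X) (f : X → ℕ) →
             ∑ₗ (filterB P xs) f ≡ ∑[ x ∈ xs ] indicator (P x) * f x
∑ₗ-filterB P []       f = refl
∑ₗ-filterB P (x ∷ xs) f with P x
... | true  = cong₂ _+_ (sym (+-identityʳ (f x))) (∑ₗ-filterB P xs f)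
... | false = ∑ₗ-filterB P xs f

++-head-tail : ∀ {m n} (xs : Fin (suc m) → X) (ys : Fin n → X) →
               xs ++ᵥ ys ≗ xs zero ∷ᵥ (xs ∘ suc ++ᵥ ys)
++-head-tail xs ys zero    = refl
++-head-tail {m = m} xs ys (suc i) with splitAt m i
... | inj₁ _ = refl
... | inj₂ _ = refl

sumTuples : (m M : ℕ) → ((Fin m → Fin M) → ℕ) → ℕ
sumTuples zero    M g = g (λ ())
sumTuples (suc m) M g = ∑[ a < M ] sumTuples m M (λ x → g (a ∷ᵥ x))

TupleCongruent : ∀ {m M} → ((Fin m → Fin M) → ℕ) → Set
TupleCongruent g = Congruent _≗_ _≡_ g

sumTuples-cong : ∀ m M {f g : (Fin m → Fin M) → ℕ} → f ≗ g →
                 sumTuples m M f ≡ sumTuples m M g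
sumTuples-cong zero    M f≗g = f≗g _
sumTuples-cong (suc m) M f≗g = sum-cong-≗ (λ a → sumTuples-cong m M (f≗g ∘ (a ∷ᵥ_)))

*-distribˡ-sumTuples : ∀ m M c (f : (Fin m → Fin M) → ℕ) →
                       c * sumTuples m M f ≡ sumTuples m M (λ x → c * f x)
*-distribˡ-sumTuples zero    M c f = refl
*-distribˡ-sumTuples (suc m) M c f =
  trans (*-distribˡ-sum {M} c (λ a → sumTuples m M (λ x → f (a ∷ᵥ x))))
        (sum-cong-≗ (λ a → *-distribˡ-sumTuples m M c (λ x → f (a ∷ᵥ x))))

∷-congruent : ∀ {m M} {g : (Fin (suc m) → Fin M) → ℕ} → TupleCongruent g →
              ∀ a → TupleCongruent (λ x → g (a ∷ᵥ x))
∷-congruent g-cong a x≗y = g-cong λ { zero → refl ; (suc i) → x≗y i }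

sumTuples-++ : ∀ m n M (g : (Fin (m + n) → Fin M) → ℕ) → TupleCongruent g →
               sumTuples (m + n) M g ≡ sumTuples m M (λ x → sumTuples n M (λ y → g (x ++ᵥ y)))
sumTuples-++ zero    n M g g-cong = refl
sumTuples-++ (suc m) n M g g-cong = sum-cong-≗ λ a →
  trans (sumTuples-++ m n M _ (∷-congruent g-cong a))
        (sumTuples-cong m M λ x → sumTuples-cong n M λ y → g-cong (sym ∘ ++-head-tail (a ∷ᵥ x) y))

∑ₗ-allTuples : ∀ m M (g : (Fin m → Fin M) → ℕ) → TupleCongruent g →
               ∑ₗ (allTuples m M) g ≡ sumTuples m M g
∑ₗ-allTuples zero    M g g-cong = trans (+-identityʳ _) (g-cong (λ ()))
∑ₗ-allTuples (suc m) M g g-cong = begin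
  ∑ₗ (allTuples (suc m) M) g
    ≡⟨ ∑ₗ-concatMap _ (allFin M) g ⟩
  ∑[ a ∈ allFin M ] ∑ₗ (map (a ∷ᵥ_) (allTuples m M)) g
    ≡⟨ ∑ₗ-cong (allFin M) (λ a → ∑ₗ-map (a ∷ᵥ_) (allTuples m M) g) ⟩
  ∑[ a ∈ allFin M ] ∑[ x ∈ allTuples m M ] g (a ∷ᵥ x)
    ≡⟨ ∑ₗ-cong (allFin M) (λ a → ∑ₗ-allTuples m M _ (∷-congruent g-cong a)) ⟩
  ∑[ a ∈ allFin M ] sumTuples m M (λ x → g (a ∷ᵥ x))
    ≡⟨ ∑ₗ-tabulate id (λ a → sumTuples m M (λ x → g (a ∷ᵥ x))) ⟩
  sumTuples (suc m) M g ∎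
  where open ≡-Reasoning

Distinct : ∀ {d M} → List (Fin d → Fin M) → Set
Distinct = AllPairs (λ x y → ¬ (x ≗ y))

lookup-injective : ∀ {d M} {xs : List (Fin d → Fin M)} → Distinct xs →
                   ∀ i j → lookup xs i ≗ lookup xs j → i ≡ j
lookup-injective (x≉ ∷ xs!) zero    zero    _  = refl
lookup-injective (x≉ ∷ xs!) zero    (suc j) eq = contradiction eq (All.lookup x≉ (∈-lookup j))
lookup-injective (x≉ ∷ xs!) (suc i) zero    eq = contradiction (sym ∘ eq) (All.lookup x≉ (∈-lookup i))
lookup-injective (x≉ ∷ xs!) (suc i) (suc j) eq = cong suc (lookup-injective xs! i j eq)

allTuples-distinct : ∀ d M → Distinct (allTuples d M)
allTuples-distinct zero    M = [] ∷ []
allTuples-distinct (suc d) M =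
  AllPairs.concat⁺ (All.map⁺ (All.universal distinct-row (allFin M)))
                   (AllPairs.map⁺ (AllPairs.tabulate⁺ rows-apart))
  where
  rows : List (Fin d → Fin M)
  rows = allTuples d M
  distinct-row : ∀ a → Distinct (map (a ∷ᵥ_) rows)
  distinct-row a =
    AllPairs.map⁺ (AllPairs.map (λ x≉y ax≗ay → x≉y (ax≗ay ∘ suc)) (allTuples-distinct d M))
  rows-apart : ∀ {a b} → a ≢ b →
               All (λ x → All (λ y → ¬ x ≗ y) (map (b ∷ᵥ_) rows)) (map (a ∷ᵥ_) rows)
  rows-apart a≢b =
    All.map⁺ (All.universal (λ x → All.map⁺ (All.universal (λ y eq → a≢b (eq zero)) rows)) rows)

filterB≡filterᵇ : (P : X → Bool) (xs : List X) → filterB P xs ≡ filterᵇ P xs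
filterB≡filterᵇ P []       = refl
filterB≡filterᵇ P (x ∷ xs) with P x
... | true  = cong (x ∷_) (filterB≡filterᵇ P xs)
... | false = filterB≡filterᵇ P xs

solutions-distinct : ∀ {σ p} (A : Structure σ) (φ : QF σ p) → Distinct (solutions A φ)
solutions-distinct {p = p} A φ =
  subst Distinct (sym (filterB≡filterᵇ (sat A φ) (allTuples p (size A))))
        (AllPairs.filter⁺ (T? ∘ sat A φ) (allTuples-distinct p (size A)))

T-does : ∀ {P : Set} (P? : Dec P) → T (does P?) ⇔ P
T-does (yes p) = mk⇔ (λ _ → p) _
T-does (no ¬p) = mk⇔ (λ ()) ¬p

-- Relations are Boolean functions of argument tuples, which need not respect pointwise equality.
Extensional : ∀ {σ} → Structure σ → Set
Extensional A = ∀ s → Congruent _≗_ _≡_ (rel A s)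

rename : ∀ {σ p q} → (Fin p → Fin q) → QF σ p → QF σ q
rename f tt       = tt
rename f ff       = ff
rename f (¬' φ)   = ¬' (rename f φ)
rename f (φ ∧' ψ) = rename f φ ∧' rename f ψ
rename f (φ ∨' ψ) = rename f φ ∨' rename f ψ
rename f (u ≐ v)  = f u ≐ f v
rename f (R s as) = R s (f ∘ as)

⋀ : ∀ {σ p} n → (Fin n → QF σ p) → QF σ p
⋀ zero    f = tt
⋀ (suc n) f = f zero ∧' ⋀ n (f ∘ suc)

module _ {σ : Signature} (A : Structure σ) where

  sat-cong : Extensional A → ∀ {p} (φ : QF σ p) → Congruent _≗_ _≡_ (sat A φ)
  sat-cong ext tt       x≗y = refl
  sat-cong ext ff       x≗y = refl
  sat-cong ext (¬' φ)   x≗y = cong not (sat-cong ext φ x≗y)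
  sat-cong ext (φ ∧' ψ) x≗y = cong₂ _∧_ (sat-cong ext φ x≗y) (sat-cong ext ψ x≗y)
  sat-cong ext (φ ∨' ψ) x≗y = cong₂ _∨_ (sat-cong ext φ x≗y) (sat-cong ext ψ x≗y)
  sat-cong ext (u ≐ v)  x≗y = cong₂ (λ a b → does (a ≟ᶠ b)) (x≗y u) (x≗y v)
  sat-cong ext (R s as) x≗y = ext s (x≗y ∘ as)

  count≡sumTuples : Extensional A → ∀ {p} (φ : QF σ p) →
                    count A φ ≡ sumTuples p (size A) (indicator ∘ sat A φ)
  count≡sumTuples ext {p} φ =
    trans (length-filterB (sat A φ) (allTuples p (size A)))
          (∑ₗ-allTuples p (size A) _ (cong indicator ∘ sat-cong ext φ))

  sat-rename : ∀ {p q} (f : Fin p → Fin q) (φ : QF σ p) (z : Fin q → Fin (size A)) →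
               sat A (rename f φ) z ≡ sat A φ (z ∘ f)
  sat-rename f tt       z = refl
  sat-rename f ff       z = refl
  sat-rename f (¬' φ)   z = cong not (sat-rename f φ z)
  sat-rename f (φ ∧' ψ) z = cong₂ _∧_ (sat-rename f φ z) (sat-rename f ψ z)
  sat-rename f (φ ∨' ψ) z = cong₂ _∨_ (sat-rename f φ z) (sat-rename f ψ z)
  sat-rename f (u ≐ v)  z = refl
  sat-rename f (R s as) z = refl

  sat-⋀-cong : ∀ {p q} n (f : Fin n → QF σ p) (g : Fin n → QF σ q) z w →
               (∀ c → sat A (f c) z ≡ sat A (g c) w) → sat A (⋀ n f) z ≡ sat A (⋀ n g) w
  sat-⋀-cong zero    f g z w eq = refl
  sat-⋀-cong (suc n) f g z w eq =
    cong₂ _∧_ (eq zero) (sat-⋀-cong n (f ∘ suc) (g ∘ suc) z w (eq ∘ suc))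

  T-sat-⋀ : ∀ {p} n (f : Fin n → QF σ p) z → T (sat A (⋀ n f) z) ⇔ (∀ c → T (sat A (f c) z))
  T-sat-⋀ zero    f z = mk⇔ (λ _ ()) _
  T-sat-⋀ (suc n) f z = mk⇔
    (λ t → let (t₀ , t₊) = Equivalence.to T-∧ t in
           λ { zero → t₀ ; (suc c) → Equivalence.to (T-sat-⋀ n (f ∘ suc) z) t₊ c })
    (λ t → Equivalence.from T-∧ (t zero , Equivalence.from (T-sat-⋀ n (f ∘ suc) z) (t ∘ suc)))

module _ {λs κ : Signature} (I : QFInterpretation λs κ) where

  private
    d : ℕ
    d = dim I

  flatten : ∀ {p} {X : Set} → (Fin p → Fin d → X) → Fin (p * d) → X
  flatten u = uncurry u ∘ remQuot d

  flatten-combine : ∀ {p} {X : Set} (u : Fin p → Fin d → X) v c → flatten u (combine v c) ≡ u v c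
  flatten-combine u v c = cong (uncurry u) (remQuot-combine v c)

  flatten-suc : ∀ {p} {X : Set} (u : Fin (suc p) → Fin d → X) →
                flatten u ≗ u zero ++ᵥ flatten (u ∘ suc)
  flatten-suc u i with splitAt d i
  ... | inj₁ _ = refl
  ... | inj₂ _ = refl

  translate : ∀ {p} → QF λs p → QF κ (p * d)
  translate tt       = tt
  translate ff       = ff
  translate (¬' φ)   = ¬' (translate φ)
  translate (φ ∧' ψ) = translate φ ∧' translate ψ
  translate (φ ∨' ψ) = translate φ ∨' translate ψ
  translate (v ≐ w)  = ⋀ d (λ c → combine v c ≐ combine w c)
  translate (R s as) = rename (flatten (combine ∘ as)) (ρ I s)

  inDomain : ∀ p → QF κ (p * d)
  inDomain p = ⋀ p (λ v → rename (combine v) (ρ₀ I))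

  relativise : ∀ {p} → QF λs p → QF κ (p * d)
  relativise {p} φ = inDomain p ∧' translate φ

  module _ (A : Structure κ) (ext : Extensional A) where

    private
      M : ℕ
      M = size A
      L : List (Fin d → Fin M)
      L = solutions A (ρ₀ I)

    interpret-extensional : Extensional (interpret I A)
    interpret-extensional s eq = sat-cong A ext (ρ I s) λ x →
      let (j , c) = remQuot {arity λs s} d x in cong (λ i → lookup L i c) (eq j)

    sat-interpret : ∀ {p} (φ : QF λs p) (idx : Fin p → Fin (length L)) →
                    sat (interpret I A) φ idx ≡ sat A (translate φ) (flatten (lookup L ∘ idx))
    sat-interpret tt       idx = refl
    sat-interpret ff       idx = refl
    sat-interpret (¬' φ)   idx = cong not (sat-interpret φ idx)
    sat-interpret (φ ∧' ψ) idx = cong₂ _∧_ (sat-interpret φ idx) (sat-interpret ψ idx)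
    sat-interpret (φ ∨' ψ) idx = cong₂ _∨_ (sat-interpret φ idx) (sat-interpret ψ idx)
    sat-interpret {p} (v ≐ w) idx =
      det (proof (idx v ≟ᶠ idx w)) (fromEquivalence same-index same-tuple)
      where
      u : Fin p → Fin d → Fin M
      u = lookup L ∘ idx
      equal-at : ∀ c → T (sat A (combine v c ≐ combine w c) (flatten u)) ⇔ u v c ≡ u w c
      equal-at c = mk⇔
        (λ t → trans (sym (flatten-combine u v c)) (trans (to t) (flatten-combine u w c)))
        (λ e → from (trans (flatten-combine u v c) (trans e (sym (flatten-combine u w c)))))
        where open Equivalence (T-does (flatten u (combine v c) ≟ᶠ flatten u (combine w c)))
      same-index : T (sat A (translate (v ≐ w)) (flatten u)) → idx v ≡ idx w
      same-index t = lookup-injective (solutions-distinct A (ρ₀ I)) (idx v) (idx w)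
        (λ c → Equivalence.to (equal-at c) (Equivalence.to (T-sat-⋀ A d _ (flatten u)) t c))
      same-tuple : idx v ≡ idx w → T (sat A (translate (v ≐ w)) (flatten u))
      same-tuple e = Equivalence.from (T-sat-⋀ A d _ (flatten u))
        (λ c → Equivalence.from (equal-at c) (cong (λ i → lookup L i c) e))
    sat-interpret (R s as) idx = sym (trans (sat-rename A _ (ρ I s) _) (sat-cong A ext (ρ I s) λ x →
      let (j , c) = remQuot {arity λs s} d x in flatten-combine (lookup L ∘ idx) (as j) c))

    sat-inDomain-++ : ∀ p (x : Fin d → Fin M) (y : Fin (p * d) → Fin M) →
                      sat A (inDomain (suc p)) (x ++ᵥ y) ≡ sat A (ρ₀ I) x ∧ sat A (inDomain p) y
    sat-inDomain-++ p x y = cong₂ _∧_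
      (trans (sat-rename A (combine {suc p} zero) (ρ₀ I) (x ++ᵥ y))
             (sat-cong A ext (ρ₀ I) (lookup-++ˡ x y)))
      (sat-⋀-cong A p _ _ (x ++ᵥ y) y λ v →
        trans (sat-rename A (combine (suc v)) (ρ₀ I) (x ++ᵥ y))
              (trans (sat-cong A ext (ρ₀ I) (lookup-++ʳ x y ∘ combine v))
                     (sym (sat-rename A (combine v) (ρ₀ I) y))))

    sumTuples-interpret : ∀ p (G : (Fin (p * d) → Fin M) → ℕ) → TupleCongruent G →
              sumTuples p (length L) (λ idx → G (flatten (lookup L ∘ idx)))
                ≡ sumTuples (p * d) M (λ z → indicator (sat A (inDomain p) z) * G z)
    sumTuples-interpret zero    G G-cong = trans (G-cong (λ ())) (sym (+-identityʳ _))
    sumTuples-interpret (suc p) G G-cong = begin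
      sumTuples (suc p) (length L) (λ idx → G (flatten (lookup L ∘ idx)))
        ≡⟨ sum-cong-≗ {length L} (λ i → sumTuples-cong p (length L) λ idx →
             G-cong (flatten-suc (lookup L ∘ (i ∷ᵥ idx)))) ⟩
      ∑[ i < length L ] sumTuples p (length L) (λ idx → G (lookup L i ++ᵥ flatten (lookup L ∘ idx)))
        ≡⟨ sum-cong-≗ {length L} (λ i →
             sumTuples-interpret p (G ∘ (lookup L i ++ᵥ_)) (G-cong ∘ ++-cong _ _ (λ _ → refl))) ⟩
      ∑[ i < length L ] K (lookup L i)
        ≡⟨ ∑ₗ-lookup L K ⟩
      ∑ₗ L K
        ≡⟨ ∑ₗ-filterB P (allTuples d M) K ⟩
      ∑[ x ∈ allTuples d M ] indicator (P x) * K x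
        ≡⟨ ∑ₗ-allTuples d M _ (λ e → cong₂ _*_ (cong indicator (sat-cong A ext (ρ₀ I) e)) (K-cong e)) ⟩
      sumTuples d M (λ x → indicator (P x) * K x)
        ≡⟨ sumTuples-cong d M (λ x → trans (*-distribˡ-sumTuples (p * d) M (indicator (P x)) _)
                                            (sumTuples-cong (p * d) M (λ y → sym (H-++ x y)))) ⟩
      sumTuples d M (λ x → sumTuples (p * d) M (λ y → H (x ++ᵥ y)))
        ≡⟨ sumTuples-++ d (p * d) M H H-cong ⟨
      sumTuples (suc p * d) M H ∎
      where
      open ≡-Reasoning
      P : (Fin d → Fin M) → Bool
      P = sat A (ρ₀ I)
      K : (Fin d → Fin M) → ℕ
      K x = sumTuples (p * d) M (λ y → indicator (sat A (inDomain p) y) * G (x ++ᵥ y))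
      K-cong : TupleCongruent K
      K-cong e = sumTuples-cong (p * d) M λ y →
        cong (indicator (sat A (inDomain p) y) *_) (G-cong (++-cong _ _ e (λ _ → refl)))
      H : (Fin (suc p * d) → Fin M) → ℕ
      H z = indicator (sat A (inDomain (suc p)) z) * G z
      H-cong : TupleCongruent H
      H-cong e = cong₂ _*_ (cong indicator (sat-cong A ext (inDomain (suc p)) e)) (G-cong e)
      H-++ : ∀ x y → H (x ++ᵥ y) ≡ indicator (P x) * (indicator (sat A (inDomain p) y) * G (x ++ᵥ y))
      H-++ x y = trans (cong (λ b → indicator b * G (x ++ᵥ y)) (sat-inDomain-++ p x y))
                       (trans (cong (_* G (x ++ᵥ y)) (indicator-∧ (P x) _))
                              (*-assoc (indicator (P x)) _ _))

    count-interpret : ∀ {p} (φ : QF λs p) → count (interpret I A) φ ≡ count A (relativise φ)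
    count-interpret {p} φ = begin
      count (interpret I A) φ
        ≡⟨ count≡sumTuples (interpret I A) interpret-extensional φ ⟩
      sumTuples p (length L) (indicator ∘ sat (interpret I A) φ)
        ≡⟨ sumTuples-cong p (length L) (cong indicator ∘ sat-interpret φ) ⟩
      sumTuples p (length L) (λ idx → G (flatten (lookup L ∘ idx)))
        ≡⟨ sumTuples-interpret p G (cong indicator ∘ sat-cong A ext (translate φ)) ⟩
      sumTuples (p * d) M (λ z → indicator (sat A (inDomain p) z) * G z)
        ≡⟨ sumTuples-cong (p * d) M (λ z → sym (indicator-∧ (sat A (inDomain p) z) _)) ⟩
      sumTuples (p * d) M (indicator ∘ sat A (relativise φ))
        ≡⟨ count≡sumTuples A ext (relativise φ) ⟨
      count A (relativise φ) ∎
      where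
      open ≡-Reasoning
      G : (Fin (p * d) → Fin M) → ℕ
      G = indicator ∘ sat A (translate φ)

Slots : ℕ → ℕ → Set
Slots m r = Fin m → Maybe (Fin r)

place : ∀ {m r M} → Slots m r → (Fin r → Fin M) → Fin m → Fin (suc M)
place σ y v = maybe (suc ∘ y) zero (σ v)

-- An assignment of m variables into Fin (suc M) is described by the variables it sends to the least
-- element zero (slot nothing) and an assignment into Fin M of the rest, numbered in order of
-- appearance.  properPatterns m lists the descriptions sending at least one variable to zero.
record Pattern (_∼_ : ℕ → ℕ → Set) (m : ℕ) : Set where
  constructor mkPattern
  field
    {rest} : ℕ
    rest∼m : rest ∼ m
    slots  : Slots m rest
open Pattern public

minFirst : ∀ {m} → Pattern _≤_ m → Pattern _<_ (suc m)
minFirst (mkPattern r≤m σ) = mkPattern (s≤s r≤m) (nothing ∷ᵥ σ)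

freshFirst : ∀ {m} → Pattern _<_ m → Pattern _<_ (suc m)
freshFirst (mkPattern r<m σ) = mkPattern (s≤s r<m) (just zero ∷ᵥ Maybe.map suc ∘ σ)

weaken : ∀ {m} → Pattern _<_ m → Pattern _≤_ m
weaken (mkPattern r<m σ) = mkPattern (<⇒≤ r<m) σ

properPatterns : (m : ℕ) → List (Pattern _<_ m)
allPatterns    : (m : ℕ) → List (Pattern _≤_ m)
allPatterns m = mkPattern ≤-refl just ∷ map weaken (properPatterns m)
properPatterns zero    = []
properPatterns (suc m) = map minFirst (allPatterns m) ++ map freshFirst (properPatterns m)

sumTuples-suc : ∀ m M (g : (Fin m → Fin (suc M)) → ℕ) → TupleCongruent g →
                sumTuples m (suc M) g ≡
                sumTuples m M (g ∘ (suc ∘_)) +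
                (∑[ t ∈ properPatterns m ] sumTuples (rest t) M (g ∘ place (slots t)))
sumTuples-suc zero    M g g-cong = trans (g-cong (λ ())) (sym (+-identityʳ _))
sumTuples-suc (suc m) M g g-cong = begin
  sumTuples m (suc M) (g-from zero) + (∑[ b < M ] sumTuples m (suc M) (g-from (suc b)))
    ≡⟨ cong₂ _+_ first-at-min first-above-min ⟩
  A + (B + C)
    ≡⟨ x∙yz≈y∙xz A B C ⟩
  B + (A + C)
    ≡⟨ cong (B +_) (sym (trans (∑ₗ-++ (map minFirst (allPatterns m)) _ _)
                               (cong₂ _+_ (∑ₗ-map minFirst (allPatterns m) _)
                                          (∑ₗ-map freshFirst (properPatterns m) _)))) ⟩
  B + (∑[ t ∈ properPatterns (suc m) ] sumTuples (rest t) M (g ∘ place (slots t))) ∎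
  where
  open ≡-Reasoning
  g-from : Fin (suc M) → (Fin m → Fin (suc M)) → ℕ
  g-from a x = g (a ∷ᵥ x)
  A B C : ℕ
  A = ∑[ t ∈ allPatterns m ] sumTuples (rest t) M (g ∘ place (nothing ∷ᵥ slots t))
  B = sumTuples (suc m) M (g ∘ (suc ∘_))
  C = ∑[ t ∈ properPatterns m ] sumTuples (suc (rest t)) M (g ∘ place (just zero ∷ᵥ Maybe.map suc ∘ slots t))
  first-at-min : sumTuples m (suc M) (g-from zero) ≡ A
  first-at-min = trans (sumTuples-suc m M _ (∷-congruent g-cong zero)) (cong₂ _+_
    (sumTuples-cong m M λ y → g-cong λ { zero → refl ; (suc v) → refl })
    (trans (∑ₗ-cong (properPatterns m) λ t → sumTuples-cong (rest t) M λ y →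
              g-cong λ { zero → refl ; (suc v) → refl })
           (sym (∑ₗ-map weaken (properPatterns m) _))))
  place-fresh : ∀ {r} (σ : Slots m r) b (y : Fin r → Fin M) →
                (suc b ∷ᵥ place σ y) ≗ place (just zero ∷ᵥ Maybe.map suc ∘ σ) (b ∷ᵥ y)
  place-fresh σ b y zero = refl
  place-fresh σ b y (suc v) with σ v
  ... | nothing = refl
  ... | just _  = refl
  first-above-min : ∑[ b < M ] sumTuples m (suc M) (g-from (suc b)) ≡ B + C
  first-above-min = begin
    ∑[ b < M ] sumTuples m (suc M) (g-from (suc b))
      ≡⟨ sum-cong-≗ {M} (λ b → sumTuples-suc m M _ (∷-congruent g-cong (suc b))) ⟩
    ∑[ b < M ] (sumTuples m M (g-from (suc b) ∘ (suc ∘_)) +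
                (∑[ t ∈ properPatterns m ] sumTuples (rest t) M (g-from (suc b) ∘ place (slots t))))
      ≡⟨ ∑-distrib-+ {M} _ _ ⟩
    (∑[ b < M ] sumTuples m M (g-from (suc b) ∘ (suc ∘_))) +
    (∑[ b < M ] (∑[ t ∈ properPatterns m ] sumTuples (rest t) M (g-from (suc b) ∘ place (slots t))))
      ≡⟨ cong₂ _+_ (sum-cong-≗ {M} λ b → sumTuples-cong m M λ y → g-cong λ { zero → refl ; (suc v) → refl })
                   (trans (∑-∑ₗ-comm M (properPatterns m) _) (∑ₗ-cong (properPatterns m) λ t →
                     sum-cong-≗ {M} λ b → sumTuples-cong (rest t) M λ y → g-cong (place-fresh (slots t) b y))) ⟩
    B + C ∎

-- [p₀, p₁, …] : NewtonPoly (suc k) stands for Σ_i C(x₀, i) · p_i(x₁, …, x_k), and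
-- evalNewtonFrom k ps r n evaluates Σ_i C(n, r + i) · p_i.
NewtonPoly : ℕ → Set
NewtonPoly zero    = ℕ
NewtonPoly (suc k) = List (NewtonPoly k)

evalNewton     : ∀ k → NewtonPoly k → (Fin k → ℕ) → ℕ
evalNewtonFrom : ∀ k → List (NewtonPoly k) → ℕ → ℕ → (Fin k → ℕ) → ℕ
evalNewton zero    c  N = c
evalNewton (suc k) ps N = evalNewtonFrom k ps 0 (N zero) (N ∘ suc)
evalNewtonFrom k []       r n N = 0
evalNewtonFrom k (p ∷ ps) r n N = (n C r) * evalNewton k p N + evalNewtonFrom k ps (suc r) n N

zeroN : ∀ k → NewtonPoly k
zeroN zero    = 0
zeroN (suc k) = []

_⊕_ : ∀ {k} → NewtonPoly k → NewtonPoly k → NewtonPoly k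
_⊕_ {zero}  a        b        = a + b
_⊕_ {suc k} []       qs       = qs
_⊕_ {suc k} (p ∷ ps) []       = p ∷ ps
_⊕_ {suc k} (p ∷ ps) (q ∷ qs) = (p ⊕ q) ∷ (ps ⊕ qs)

evalNewton-zeroN : ∀ k N → evalNewton k (zeroN k) N ≡ 0
evalNewton-zeroN zero    N = refl
evalNewton-zeroN (suc k) N = refl

evalNewton-⊕     : ∀ k (p q : NewtonPoly k) N → evalNewton k (p ⊕ q) N ≡ evalNewton k p N + evalNewton k q N
evalNewtonFrom-⊕ : ∀ k (ps qs : List (NewtonPoly k)) r n N →
                   evalNewtonFrom k (ps ⊕ qs) r n N ≡ evalNewtonFrom k ps r n N + evalNewtonFrom k qs r n N
evalNewton-⊕ zero    p  q  N = refl
evalNewton-⊕ (suc k) ps qs N = evalNewtonFrom-⊕ k ps qs 0 (N zero) (N ∘ suc)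
evalNewtonFrom-⊕ k []       qs       r n N = refl
evalNewtonFrom-⊕ k (p ∷ ps) []       r n N = sym (+-identityʳ _)
evalNewtonFrom-⊕ k (p ∷ ps) (q ∷ qs) r n N =
  trans (cong₂ _+_ (trans (cong ((n C r) *_) (evalNewton-⊕ k p q N)) (*-distribˡ-+ (n C r) _ _))
                   (evalNewtonFrom-⊕ k ps qs (suc r) n N))
        (interchange ((n C r) * evalNewton k p N) _ _ _)

sumNewton : ∀ k → List (NewtonPoly k) → NewtonPoly k
sumNewton k []       = zeroN k
sumNewton k (p ∷ ps) = p ⊕ sumNewton k ps

evalNewton-sum : ∀ k (ps : List (NewtonPoly k)) N →
                 evalNewton k (sumNewton k ps) N ≡ ∑[ p ∈ ps ] evalNewton k p N
evalNewton-sum k []       N = evalNewton-zeroN k N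
evalNewton-sum k (p ∷ ps) N =
  trans (evalNewton-⊕ k p (sumNewton k ps) N) (cong (evalNewton k p N +_) (evalNewton-sum k ps N))

evalNewtonFrom-pascal : ∀ k ps r n N →
  evalNewtonFrom k ps (suc r) (suc n) N ≡ evalNewtonFrom k ps r n N + evalNewtonFrom k ps (suc r) n N
evalNewtonFrom-pascal k []       r n N = refl
evalNewtonFrom-pascal k (p ∷ ps) r n N =
  trans (cong₂ _+_ (trans (cong (_* evalNewton k p N) (sym (nCk+nC[k+1]≡[n+1]C[k+1] n r)))
                          (*-distribʳ-+ (evalNewton k p N) (n C r) _))
                   (evalNewtonFrom-pascal k ps (suc r) n N))
        (interchange ((n C r) * evalNewton k p N) _ _ _)

evalNewtonFrom-at-0 : ∀ k ps r N → evalNewtonFrom k ps (suc r) 0 N ≡ 0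
evalNewtonFrom-at-0 k []       r N = refl
evalNewtonFrom-at-0 k (p ∷ ps) r N = evalNewtonFrom-at-0 k ps (suc r) N

newton-antidifference : ∀ k (c : NewtonPoly k) (ps : List (NewtonPoly k)) N (F : ℕ → ℕ) →
  F 0 ≡ evalNewton k c N → (∀ n → F (suc n) ≡ F n + evalNewtonFrom k ps 0 n N) →
  ∀ n → F n ≡ evalNewtonFrom k (c ∷ ps) 0 n N
newton-antidifference k c ps N F F0 ΔF zero =
  trans F0 (sym (trans (cong₂ _+_ (+-identityʳ _) (evalNewtonFrom-at-0 k ps 0 N)) (+-identityʳ _)))
newton-antidifference k c ps N F F0 ΔF (suc n) = begin
  F (suc n)
    ≡⟨ ΔF n ⟩
  F n + evalNewtonFrom k ps 0 n N
    ≡⟨ cong (_+ evalNewtonFrom k ps 0 n N) (newton-antidifference k c ps N F F0 ΔF n) ⟩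
  ((n C 0) * evalNewton k c N + evalNewtonFrom k ps 1 n N) + evalNewtonFrom k ps 0 n N
    ≡⟨ +-assoc ((n C 0) * evalNewton k c N) _ _ ⟩
  (n C 0) * evalNewton k c N + (evalNewtonFrom k ps 1 n N + evalNewtonFrom k ps 0 n N)
    ≡⟨ cong ((n C 0) * evalNewton k c N +_)
            (trans (+-comm (evalNewtonFrom k ps 1 n N) _) (sym (evalNewtonFrom-pascal k ps 0 n N))) ⟩
  (suc n C 0) * evalNewton k c N + evalNewtonFrom k ps 1 (suc n) N ∎
  where open ≡-Reasoning

evalNewton-∑ : ∀ {X : Set} k (xs : List X) (f : X → (Fin k → ℕ) → ℕ) (e : X → NewtonPoly k) →
               (∀ x N → f x N ≡ evalNewton k (e x) N) →
               ∀ N → ∑[ x ∈ xs ] f x N ≡ evalNewton k (sumNewton k (map e xs)) N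
evalNewton-∑ k xs f e f≡e N =
  trans (∑ₗ-cong xs (λ x → f≡e x N))
        (trans (sym (∑ₗ-map e xs (λ p → evalNewton k p N))) (sym (evalNewton-sum k (map e xs) N)))

module ColouredOrder (Colour : Set) (_≟ᶜ_ : DecidableEquality Colour) where

  data Formula (m : ℕ) : Set where
    tt ff     : Formula m
    ¬'        : Formula m → Formula m
    _∧'_ _∨'_ : Formula m → Formula m → Formula m
    _≐_ _≺_   : Fin m → Fin m → Formula m
    _∈ᶜ_      : Fin m → Colour → Formula m

  Colouring : ℕ → Set
  Colouring M = Fin M → Colour

  ⟦_⟧ : ∀ {m M} → Formula m → Colouring M → (Fin m → Fin M) → Bool
  ⟦ tt ⟧     col x = true
  ⟦ ff ⟧     col x = false
  ⟦ ¬' φ ⟧   col x = not (⟦ φ ⟧ col x)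
  ⟦ φ ∧' ψ ⟧ col x = ⟦ φ ⟧ col x ∧ ⟦ ψ ⟧ col x
  ⟦ φ ∨' ψ ⟧ col x = ⟦ φ ⟧ col x ∨ ⟦ ψ ⟧ col x
  ⟦ v ≐ w ⟧  col x = does (x v ≟ᶠ x w)
  ⟦ v ≺ w ⟧  col x = does (toℕ (x v) ℕ.<? toℕ (x w))
  ⟦ v ∈ᶜ c ⟧ col x = does (c ≟ᶜ col (x v))

  ⟦⟧-cong : ∀ {m M} (φ : Formula m) {col col′ : Colouring M} {x y : Fin m → Fin M} →
            col ≗ col′ → x ≗ y → ⟦ φ ⟧ col x ≡ ⟦ φ ⟧ col′ y
  ⟦⟧-cong tt       col≗ x≗ = refl
  ⟦⟧-cong ff       col≗ x≗ = refl
  ⟦⟧-cong (¬' φ)   col≗ x≗ = cong not (⟦⟧-cong φ col≗ x≗)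
  ⟦⟧-cong (φ ∧' ψ) col≗ x≗ = cong₂ _∧_ (⟦⟧-cong φ col≗ x≗) (⟦⟧-cong ψ col≗ x≗)
  ⟦⟧-cong (φ ∨' ψ) col≗ x≗ = cong₂ _∨_ (⟦⟧-cong φ col≗ x≗) (⟦⟧-cong ψ col≗ x≗)
  ⟦⟧-cong (v ≐ w)  col≗ x≗ = cong₂ (λ a b → does (a ≟ᶠ b)) (x≗ v) (x≗ w)
  ⟦⟧-cong (v ≺ w)  col≗ x≗ = cong₂ (λ a b → does (toℕ a ℕ.<? toℕ b)) (x≗ v) (x≗ w)
  ⟦⟧-cong (v ∈ᶜ c) {col} {y = y} col≗ x≗ = cong (λ a → does (c ≟ᶜ a)) (trans (cong col (x≗ v)) (col≗ (y v)))

  countᶜ : ∀ {m M} → Colouring M → Formula m → ℕ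
  countᶜ {m} {M} col φ = sumTuples m M (indicator ∘ ⟦ φ ⟧ col)

  countᶜ-cong : ∀ {m M} {col col′ : Colouring M} (φ : Formula m) → col ≗ col′ → countᶜ col φ ≡ countᶜ col′ φ
  countᶜ-cong {m} {M} φ col≗ = sumTuples-cong m M (λ x → cong indicator (⟦⟧-cong φ col≗ (λ _ → refl)))

  fromBool : ∀ {m} → Bool → Formula m
  fromBool b = if b then tt else ff

  ⟦fromBool⟧ : ∀ {m M} b (col : Colouring M) (x : Fin m → Fin M) → ⟦ fromBool b ⟧ col x ≡ b
  ⟦fromBool⟧ true  col x = refl
  ⟦fromBool⟧ false col x = refl

  -- The new least element has colour a, equals no other element and lies below all of them.
  specialise : ∀ {m r} → Colour → Slots m r → Formula m → Formula r
  specialise a σ tt       = tt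
  specialise a σ ff       = ff
  specialise a σ (¬' φ)   = ¬' (specialise a σ φ)
  specialise a σ (φ ∧' ψ) = specialise a σ φ ∧' specialise a σ ψ
  specialise a σ (φ ∨' ψ) = specialise a σ φ ∨' specialise a σ ψ
  specialise a σ (v ≐ w) with σ v | σ w
  ... | nothing | nothing = tt
  ... | just i  | just j  = i ≐ j
  ... | _       | _       = ff
  specialise a σ (v ≺ w) with σ v | σ w
  ... | nothing | just _  = tt
  ... | just i  | just j  = i ≺ j
  ... | _       | _       = ff
  specialise a σ (v ∈ᶜ c) with σ v
  ... | nothing = fromBool (does (c ≟ᶜ a))
  ... | just i  = i ∈ᶜ c

  ⟦specialise⟧ : ∀ {m r M} a (col : Colouring M) (σ : Slots m r) (φ : Formula m) (y : Fin r → Fin M) →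
                 ⟦ φ ⟧ (a ∷ᵥ col) (place σ y) ≡ ⟦ specialise a σ φ ⟧ col y
  ⟦specialise⟧ a col σ tt       y = refl
  ⟦specialise⟧ a col σ ff       y = refl
  ⟦specialise⟧ a col σ (¬' φ)   y = cong not (⟦specialise⟧ a col σ φ y)
  ⟦specialise⟧ a col σ (φ ∧' ψ) y = cong₂ _∧_ (⟦specialise⟧ a col σ φ y) (⟦specialise⟧ a col σ ψ y)
  ⟦specialise⟧ a col σ (φ ∨' ψ) y = cong₂ _∨_ (⟦specialise⟧ a col σ φ y) (⟦specialise⟧ a col σ ψ y)
  ⟦specialise⟧ a col σ (v ≐ w) y with σ v | σ w
  ... | nothing | nothing = refl
  ... | nothing | just _  = refl
  ... | just _  | nothing = refl
  ... | just _  | just _  = refl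
  ⟦specialise⟧ a col σ (v ≺ w) y with σ v | σ w
  ... | nothing | nothing = refl
  ... | nothing | just _  = refl
  ... | just _  | nothing = refl
  ... | just _  | just _  = refl
  ⟦specialise⟧ a col σ (v ∈ᶜ c) y with σ v
  ... | nothing = sym (⟦fromBool⟧ _ col y)
  ... | just _  = refl

  ⟦⟧-suc : ∀ {m M} a (col : Colouring M) (φ : Formula m) (y : Fin m → Fin M) →
           ⟦ φ ⟧ (a ∷ᵥ col) (suc ∘ y) ≡ ⟦ φ ⟧ col y
  ⟦⟧-suc a col tt       y = refl
  ⟦⟧-suc a col ff       y = refl
  ⟦⟧-suc a col (¬' φ)   y = cong not (⟦⟧-suc a col φ y)
  ⟦⟧-suc a col (φ ∧' ψ) y = cong₂ _∧_ (⟦⟧-suc a col φ y) (⟦⟧-suc a col ψ y)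
  ⟦⟧-suc a col (φ ∨' ψ) y = cong₂ _∨_ (⟦⟧-suc a col φ y) (⟦⟧-suc a col ψ y)
  ⟦⟧-suc a col (v ≐ w)  y = refl
  ⟦⟧-suc a col (v ≺ w)  y = refl
  ⟦⟧-suc a col (v ∈ᶜ c) y = refl

  countᶜ-∷ : ∀ {m M} a (col : Colouring M) (φ : Formula m) →
             countᶜ (a ∷ᵥ col) φ ≡
             countᶜ col φ + (∑[ t ∈ properPatterns m ] countᶜ col (specialise a (slots t) φ))
  countᶜ-∷ {m} {M} a col φ =
    trans (sumTuples-suc m M _ (cong indicator ∘ ⟦⟧-cong φ (λ _ → refl)))
          (cong₂ _+_ (sumTuples-cong m M (cong indicator ∘ ⟦⟧-suc a col φ))
                     (∑ₗ-cong (properPatterns m) λ t →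
                       sumTuples-cong (rest t) M (cong indicator ∘ ⟦specialise⟧ a col (slots t) φ)))

  NewtonCount : (k : ℕ) {S : (Fin k → ℕ) → ℕ} → ((N : Fin k → ℕ) → Colouring (S N)) → ∀ {m} → Formula m → Set
  NewtonCount k col φ = Σ (NewtonPoly k) λ e → ∀ N → countᶜ (col N) φ ≡ evalNewton k e N

  NewtonCounts : (k : ℕ) (S : (Fin k → ℕ) → ℕ) → ((N : Fin k → ℕ) → Colouring (S N)) → Set
  NewtonCounts k S col = ∀ {m} (φ : Formula m) → NewtonCount k col φ

  newtonCounts-∷ : ∀ {k S col} a → NewtonCounts k S col → NewtonCounts k (suc ∘ S) (λ N → a ∷ᵥ col N)
  newtonCounts-∷ {k} {S} {col} a counts {m} φ = proj₁ (counts φ) ⊕ specialised , λ N → begin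
    countᶜ (a ∷ᵥ col N) φ
      ≡⟨ countᶜ-∷ a (col N) φ ⟩
    countᶜ (col N) φ + (∑[ t ∈ properPatterns m ] countᶜ (col N) (specialise a (slots t) φ))
      ≡⟨ cong₂ _+_ (proj₂ (counts φ) N)
                   (evalNewton-∑ k (properPatterns m) _ (proj₁ ∘ counts-at) (proj₂ ∘ counts-at) N) ⟩
    evalNewton k (proj₁ (counts φ)) N + evalNewton k specialised N
      ≡⟨ evalNewton-⊕ k _ specialised N ⟨
    evalNewton k (proj₁ (counts φ) ⊕ specialised) N ∎
    where
    open ≡-Reasoning
    counts-at : (t : Pattern _<_ m) → NewtonCount k col (specialise a (slots t) φ)
    counts-at t = counts (specialise a (slots t) φ)
    specialised : NewtonPoly k
    specialised = sumNewton k (map (proj₁ ∘ counts-at) (properPatterns m))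

  newtonCounts-++ : ∀ {k S col} {ℓ} (ps : Fin ℓ → Colour) → NewtonCounts k S col →
                    NewtonCounts k (λ N → ℓ + S N) (λ N → ps ++ᵥ col N)
  newtonCounts-++ {ℓ = zero}  ps counts = counts
  newtonCounts-++ {ℓ = suc ℓ} ps counts φ =
    let (e , eq) = newtonCounts-∷ (ps zero) (newtonCounts-++ (ps ∘ suc) counts) φ in
    e , λ N → trans (countᶜ-cong φ (++-head-tail ps _)) (eq N)

  -- Strong induction on the number of variables: by countᶜ-∷ and the induction hypothesis, putting
  -- n + 1 rather than n points of colour a in front adds a polynomial in (n, N), so the count is a
  -- discrete antiderivative of one.
  newtonCounts-block : ∀ {k S col} a → NewtonCounts k S col →
                       NewtonCounts (suc k) (λ N → N zero + S (N ∘ suc))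
                                            (λ N → replicate (N zero) a ++ᵥ col (N ∘ suc))
  newtonCounts-block {k} {S} {col} a counts {m} = <-rec Counted step m
    where
    block : (n : ℕ) (N : Fin k → ℕ) → Colouring (n + S N)
    block n N = replicate n a ++ᵥ col N
    Counted : ℕ → Set
    Counted m = (φ : Formula m) → NewtonCount (suc k) (λ N → block (N zero) (N ∘ suc)) φ
    step : ∀ m → (∀ {r} → r < m → Counted r) → Counted m
    step m counted φ = proj₁ (counts φ) ∷ increments , λ N →
      newton-antidifference k _ increments (N ∘ suc) (λ n → countᶜ (block n (N ∘ suc)) φ)
                            (proj₂ (counts φ) (N ∘ suc)) (Δ (N ∘ suc)) (N zero)
      where
      counted-at : (t : Pattern _<_ m) →
                   NewtonCount (suc k) (λ N → block (N zero) (N ∘ suc)) (specialise a (slots t) φ)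
      counted-at t = counted (rest∼m t) (specialise a (slots t) φ)
      increments : NewtonPoly (suc k)
      increments = sumNewton (suc k) (map (proj₁ ∘ counted-at) (properPatterns m))
      Δ : ∀ N n → countᶜ (block (suc n) N) φ ≡ countᶜ (block n N) φ + evalNewtonFrom k increments 0 n N
      Δ N n = trans (countᶜ-cong φ (++-head-tail (replicate (suc n) a) (col N)))
                    (trans (countᶜ-∷ a (block n N) φ)
                           (cong (countᶜ (block n N) φ +_) (evalNewton-∑ (suc k) (properPatterns m) _
                                                              (proj₁ ∘ counted-at) (proj₂ ∘ counted-at) (n ∷ᵥ N))))

  blocks : ∀ {k} → (Fin k → Colour) → (N : Fin k → ℕ) → Colouring (sumN k N)
  blocks {zero}  cs N = λ ()
  blocks {suc k} cs N = replicate (N zero) (cs zero) ++ᵥ blocks (cs ∘ suc) (N ∘ suc)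

  blocks-decodeT : ∀ {k} (cs : Fin k → Colour) (N : Fin k → ℕ) y → blocks cs N y ≡ cs (proj₁ (decodeT k N y))
  blocks-decodeT {suc k} cs N y with splitAt (N zero) y
  ... | inj₁ _  = refl
  ... | inj₂ y′ with decodeT k (N ∘ suc) y′ | blocks-decodeT (cs ∘ suc) (N ∘ suc) y′
  ... | i , _ | eq = eq

  newtonCounts-blocks : ∀ {k} (cs : Fin k → Colour) → NewtonCounts k (sumN k) (blocks cs)
  newtonCounts-blocks {zero}  cs φ = countᶜ (λ ()) φ , λ N → countᶜ-cong φ (λ ())
  newtonCounts-blocks {suc k} cs   = newtonCounts-block (cs zero) (newtonCounts-blocks (cs ∘ suc))

does-<?-+ : ∀ c a b → does (a ℕ.<? b) ≡ does (c + a ℕ.<? c + b)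
does-<?-+ zero    a b = refl
does-<?-+ (suc c) a b = does-<?-+ c a b

offset : ∀ {k} (N : Fin k → ℕ) → Fin k → ℕ
offset N zero    = 0
offset N (suc i) = N zero + offset (N ∘ suc) i

toℕ-decodeT : ∀ k (N : Fin k → ℕ) y → let (i , j) = decodeT k N y in toℕ y ≡ offset N i + toℕ j
toℕ-decodeT (suc k) N y with splitAt (N zero) y in eq
... | inj₁ j = trans (sym (cong toℕ (splitAt⁻¹-↑ˡ eq))) (toℕ-↑ˡ j _)
... | inj₂ y′ with decodeT k (N ∘ suc) y′ | toℕ-decodeT k (N ∘ suc) y′
... | i , j | y′≡ =
  trans (sym (cong toℕ (splitAt⁻¹-↑ʳ eq)))
        (trans (toℕ-↑ʳ (N zero) y′) (trans (cong (N zero +_) y′≡) (sym (+-assoc (N zero) _ _))))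

module BasicAsColoured (k ℓ : ℕ) where

  Colour : Set
  Colour = Fin ℓ ⊎ Fin k

  open ColouredOrder Colour (≡-dec _≟ᶠ_ _≟ᶠ_) public

  atom : ∀ {m} (c : Fin ℓ ⊎ (Fin k ⊎ Fin k)) → (Fin (βarity {k} {ℓ} c) → Fin m) → Formula m
  atom (inj₁ e)        as = as zero ∈ᶜ inj₁ e
  atom (inj₂ (inj₁ i)) as = as zero ∈ᶜ inj₂ i
  atom (inj₂ (inj₂ i)) as = (as zero ∈ᶜ inj₂ i) ∧' ((as (suc zero) ∈ᶜ inj₂ i) ∧' (as zero ≺ as (suc zero)))

  toColoured : ∀ {m} → QF (β k ℓ) m → Formula m
  toColoured tt       = tt
  toColoured ff       = ff
  toColoured (¬' φ)   = ¬' (toColoured φ)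
  toColoured (φ ∧' ψ) = toColoured φ ∧' toColoured ψ
  toColoured (φ ∨' ψ) = toColoured φ ∨' toColoured ψ
  toColoured (v ≐ w)  = v ≐ w
  toColoured (R s as) = atom (βsplit k ℓ s) as

  module _ (N : Fin k → ℕ) where

    colour : Colouring (ℓ + sumN k N)
    colour z = [ inj₁ , inj₂ ∘ proj₁ ]′ (decodeB k ℓ N z)

    colour≗ : colour ≗ inj₁ ++ᵥ blocks inj₂ N
    colour≗ z with splitAt ℓ z
    ... | inj₁ e = refl
    ... | inj₂ y = sym (blocks-decodeT inj₂ N y)

    toℕ-decodeB : ∀ z i j → decodeB k ℓ N z ≡ inj₂ (i , j) → toℕ z ≡ (ℓ + offset N i) + toℕ j
    toℕ-decodeB z i j e with splitAt ℓ z in eq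
    toℕ-decodeB z i j refl | inj₂ y =
      trans (sym (cong toℕ (splitAt⁻¹-↑ʳ eq)))
            (trans (toℕ-↑ʳ ℓ y) (trans (cong (ℓ +_) (toℕ-decodeT k N y)) (sym (+-assoc ℓ _ _))))

    βrel≡⟦atom⟧ : ∀ {m} c (as : Fin (βarity {k} {ℓ} c) → Fin m) x →
                  βrel k ℓ N c (x ∘ as) ≡ ⟦ atom c as ⟧ colour x
    βrel≡⟦atom⟧ (inj₁ e) as x with decodeB k ℓ N (x (as zero))
    ... | inj₁ _ = refl
    ... | inj₂ _ = refl
    βrel≡⟦atom⟧ (inj₂ (inj₁ i)) as x with decodeB k ℓ N (x (as zero))
    ... | inj₁ _ = refl
    ... | inj₂ _ = refl
    βrel≡⟦atom⟧ (inj₂ (inj₂ i)) as x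
      with decodeB k ℓ N (x (as zero)) in e₀ | decodeB k ℓ N (x (as (suc zero))) in e₁
    ... | inj₁ _         | _              = refl
    ... | inj₂ (i₀ , j₀) | inj₁ _ with does (i ≟ᶠ i₀)
    ...   | true  = refl
    ...   | false = refl
    βrel≡⟦atom⟧ (inj₂ (inj₂ i)) as x | inj₂ (i₀ , j₀) | inj₂ (i₁ , j₁) with i ≟ᶠ i₀ | i ≟ᶠ i₁
    ...   | no _     | _        = refl
    ...   | yes _    | no _     = refl
    ...   | yes refl | yes refl =
      trans (does-<?-+ (ℓ + offset N i) (toℕ j₀) (toℕ j₁))
            (sym (cong₂ (λ a b → does (a ℕ.<? b)) (toℕ-decodeB _ i j₀ e₀) (toℕ-decodeB _ i j₁ e₁)))

    sat≡⟦toColoured⟧ : ∀ {m} (φ : QF (β k ℓ) m) x → sat (basic k ℓ N) φ x ≡ ⟦ toColoured φ ⟧ colour x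
    sat≡⟦toColoured⟧ tt       x = refl
    sat≡⟦toColoured⟧ ff       x = refl
    sat≡⟦toColoured⟧ (¬' φ)   x = cong not (sat≡⟦toColoured⟧ φ x)
    sat≡⟦toColoured⟧ (φ ∧' ψ) x = cong₂ _∧_ (sat≡⟦toColoured⟧ φ x) (sat≡⟦toColoured⟧ ψ x)
    sat≡⟦toColoured⟧ (φ ∨' ψ) x = cong₂ _∨_ (sat≡⟦toColoured⟧ φ x) (sat≡⟦toColoured⟧ ψ x)
    sat≡⟦toColoured⟧ (v ≐ w)  x = refl
    sat≡⟦toColoured⟧ (R s as) x = βrel≡⟦atom⟧ (βsplit k ℓ s) as x

    basic-extensional : Extensional (basic k ℓ N)
    basic-extensional s {a} {b} a≗b = begin
      βrel k ℓ N c a                   ≡⟨ βrel≡⟦atom⟧ c id a ⟩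
      ⟦ atom c id ⟧ colour a           ≡⟨ ⟦⟧-cong (atom c id) (λ _ → refl) a≗b ⟩
      ⟦ atom c id ⟧ colour b           ≡⟨ βrel≡⟦atom⟧ c id b ⟨
      βrel k ℓ N c b                   ∎
      where
      open ≡-Reasoning
      c : Fin ℓ ⊎ (Fin k ⊎ Fin k)
      c = βsplit k ℓ s

    count-basic : ∀ {m} (φ : QF (β k ℓ) m) →
                  count (basic k ℓ N) φ ≡ countᶜ (inj₁ ++ᵥ blocks inj₂ N) (toColoured φ)
    count-basic {m} φ =
      trans (count≡sumTuples (basic k ℓ N) basic-extensional φ)
            (trans (sumTuples-cong m (ℓ + sumN k N) (cong indicator ∘ sat≡⟦toColoured⟧ φ))
                   (countᶜ-cong (toColoured φ) colour≗))

  count-basic-newton : ∀ {m} (φ : QF (β k ℓ) m) →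
                       Σ (NewtonPoly k) λ e → ∀ N → count (basic k ℓ N) φ ≡ evalNewton k e N
  count-basic-newton φ =
    let (e , eq) = newtonCounts-++ inj₁ (newtonCounts-blocks inj₂) (toColoured φ) in
    e , λ N → trans (count-basic N φ) (eq N)

open +-*-Solver using (solve; _:+_; _:-_; _:*_; _:=_)

ℕtoℚ≡mkℚ : ∀ n → ℕtoℚ n ≡ mkℚ (ℤ.+ n) 0 (coprime-sym (1-coprimeTo n))
ℕtoℚ≡mkℚ n = ℚ.normalize-coprime (coprime-sym (1-coprimeTo n))

ℕtoℚ-+ : ∀ a b → ℕtoℚ (a + b) ≡ ℕtoℚ a ℚ.+ ℕtoℚ b
ℕtoℚ-+ a b = ℚ.toℚᵘ-injective (ℚᵘ.≃-trans lhs (ℚᵘ.≃-sym (ℚ.toℚᵘ-homo-+ (ℕtoℚ a) (ℕtoℚ b))))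
  where
  lhs : toℚᵘ (ℕtoℚ (a + b)) ℚᵘ.≃ toℚᵘ (ℕtoℚ a) ℚᵘ.+ toℚᵘ (ℕtoℚ b)
  lhs rewrite ℕtoℚ≡mkℚ (a + b) | ℕtoℚ≡mkℚ a | ℕtoℚ≡mkℚ b =
    ℚᵘ.*≡* (trans (ℤ.*-identityʳ _)
                  (sym (trans (ℤ.*-identityʳ _) (cong₂ ℤ._+_ (ℤ.*-identityʳ (ℤ.+ a)) (ℤ.*-identityʳ (ℤ.+ b))))))

ℕtoℚ-* : ∀ a b → ℕtoℚ (a * b) ≡ ℕtoℚ a ℚ.* ℕtoℚ b
ℕtoℚ-* a b = ℚ.toℚᵘ-injective (ℚᵘ.≃-trans lhs (ℚᵘ.≃-sym (ℚ.toℚᵘ-homo-* (ℕtoℚ a) (ℕtoℚ b))))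
  where
  lhs : toℚᵘ (ℕtoℚ (a * b)) ℚᵘ.≃ toℚᵘ (ℕtoℚ a) ℚᵘ.* toℚᵘ (ℕtoℚ b)
  lhs rewrite ℕtoℚ≡mkℚ (a * b) | ℕtoℚ≡mkℚ a | ℕtoℚ≡mkℚ b =
    ℚᵘ.*≡* (trans (ℤ.*-identityʳ _) (sym (trans (ℤ.*-identityʳ _) (sym (ℤ.pos-* a b)))))

_+ᴾ_ : Poly → Poly → Poly
[]       +ᴾ q        = q
(c ∷ cs) +ᴾ []       = c ∷ cs
(c ∷ cs) +ᴾ (d ∷ ds) = (c ℚ.+ d) ∷ (cs +ᴾ ds)

_·ᴾ_ : ℚ → Poly → Poly
c ·ᴾ []       = []
c ·ᴾ (d ∷ ds) = (c ℚ.* d) ∷ (c ·ᴾ ds)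

_*ᴾ_ : Poly → Poly → Poly
[]       *ᴾ q = []
(c ∷ cs) *ᴾ q = (c ·ᴾ q) +ᴾ (0ℚ ∷ (cs *ᴾ q))

evalPoly-+ᴾ : ∀ p q n → evalPoly (p +ᴾ q) n ≡ evalPoly p n ℚ.+ evalPoly q n
evalPoly-+ᴾ []       q        n = sym (ℚ.+-identityˡ _)
evalPoly-+ᴾ (c ∷ cs) []       n = sym (ℚ.+-identityʳ _)
evalPoly-+ᴾ (c ∷ cs) (d ∷ ds) n =
  trans (cong (λ t → c ℚ.+ d ℚ.+ ℕtoℚ n ℚ.* t) (evalPoly-+ᴾ cs ds n))
        (solve 5 (λ c d x u v → c :+ d :+ x :* (u :+ v) := (c :+ x :* u) :+ (d :+ x :* v))
               refl c d (ℕtoℚ n) _ _)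

evalPoly-·ᴾ : ∀ c p n → evalPoly (c ·ᴾ p) n ≡ c ℚ.* evalPoly p n
evalPoly-·ᴾ c []       n = sym (ℚ.*-zeroʳ c)
evalPoly-·ᴾ c (d ∷ ds) n =
  trans (cong (λ t → c ℚ.* d ℚ.+ ℕtoℚ n ℚ.* t) (evalPoly-·ᴾ c ds n))
        (solve 4 (λ c d x u → c :* d :+ x :* (c :* u) := c :* (d :+ x :* u)) refl c d (ℕtoℚ n) _)

evalPoly-*ᴾ : ∀ p q n → evalPoly (p *ᴾ q) n ≡ evalPoly p n ℚ.* evalPoly q n
evalPoly-*ᴾ []       q n = sym (ℚ.*-zeroˡ (evalPoly q n))
evalPoly-*ᴾ (c ∷ cs) q n = begin
  evalPoly ((c ·ᴾ q) +ᴾ (0ℚ ∷ (cs *ᴾ q))) n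
    ≡⟨ evalPoly-+ᴾ (c ·ᴾ q) _ n ⟩
  evalPoly (c ·ᴾ q) n ℚ.+ (0ℚ ℚ.+ ℕtoℚ n ℚ.* evalPoly (cs *ᴾ q) n)
    ≡⟨ cong₂ ℚ._+_ (evalPoly-·ᴾ c q n) (trans (ℚ.+-identityˡ _) (cong (ℕtoℚ n ℚ.*_) (evalPoly-*ᴾ cs q n))) ⟩
  c ℚ.* evalPoly q n ℚ.+ ℕtoℚ n ℚ.* (evalPoly cs n ℚ.* evalPoly q n)
    ≡⟨ solve 4 (λ c x u v → c :* v :+ x :* (u :* v) := (c :+ x :* u) :* v) refl c (ℕtoℚ n) _ _ ⟩
  (c ℚ.+ ℕtoℚ n ℚ.* evalPoly cs n) ℚ.* evalPoly q n ∎
  where open ≡-Reasoning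

IsPolynomial : (ℕ → ℚ) → Set
IsPolynomial f = Σ Poly λ P → ∀ n → f n ≡ evalPoly P n

isPolynomial-cong : ∀ {f g} → (∀ n → f n ≡ g n) → IsPolynomial g → IsPolynomial f
isPolynomial-cong f≡g (P , g≡P) = P , λ n → trans (f≡g n) (g≡P n)

isPolynomial-const : ∀ c → IsPolynomial (λ _ → c)
isPolynomial-const c = (c ∷ []) , λ n → sym (trans (cong (c ℚ.+_) (ℚ.*-zeroʳ (ℕtoℚ n))) (ℚ.+-identityʳ c))

isPolynomial-+ : ∀ {f g} → IsPolynomial f → IsPolynomial g → IsPolynomial (λ n → f n ℚ.+ g n)
isPolynomial-+ (P , f≡P) (Q , g≡Q) =
  P +ᴾ Q , λ n → trans (cong₂ ℚ._+_ (f≡P n) (g≡Q n)) (sym (evalPoly-+ᴾ P Q n))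

isPolynomial-* : ∀ {f g} → IsPolynomial f → IsPolynomial g → IsPolynomial (λ n → f n ℚ.* g n)
isPolynomial-* (P , f≡P) (Q , g≡Q) =
  P *ᴾ Q , λ n → trans (cong₂ ℚ._*_ (f≡P n) (g≡Q n)) (sym (evalPoly-*ᴾ P Q n))

absorption : ∀ x r → suc r * (x C suc r) + r * (x C r) ≡ x * (x C r)
absorption zero    zero    = refl
absorption zero    (suc r) = cong₂ _+_ (*-zeroʳ (suc (suc r))) (*-zeroʳ (suc r))
absorption (suc x) zero    = begin
  1 * (suc x C 1) + 0 ≡⟨ cong (λ c → 1 * c + 0) (nC1≡n (suc x)) ⟩
  1 * suc x + 0       ≡⟨ trans (+-identityʳ _) (trans (*-identityˡ _) (sym (*-identityʳ _))) ⟩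
  suc x * 1           ∎
  where open ≡-Reasoning
absorption (suc x) (suc r)
  rewrite sym (nCk+nC[k+1]≡[n+1]C[k+1] x r) | sym (nCk+nC[k+1]≡[n+1]C[k+1] x (suc r)) = begin
  (2 + r) * (B₁ + B₂) + (1 + r) * (B₀ + B₁)
    ≡⟨ regroup r B₀ B₁ B₂ ⟩
  ((2 + r) * B₂ + (1 + r) * B₁) + B₁ + ((1 + r) * B₁ + r * B₀) + B₀
    ≡⟨ cong₂ (λ a b → a + B₁ + b + B₀) (absorption x (suc r)) (absorption x r) ⟩
  x * B₁ + B₁ + x * B₀ + B₀
    ≡⟨ collect x B₀ B₁ ⟩
  suc x * (B₀ + B₁) ∎
  where
  open ≡-Reasoning
  B₀ B₁ B₂ : ℕ
  B₀ = x C r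
  B₁ = x C suc r
  B₂ = x C suc (suc r)
  regroup : ∀ r B₀ B₁ B₂ → (2 + r) * (B₁ + B₂) + (1 + r) * (B₀ + B₁) ≡
            ((2 + r) * B₂ + (1 + r) * B₁) + B₁ + ((1 + r) * B₁ + r * B₀) + B₀
  regroup = solve-∀
  collect : ∀ x B₀ B₁ → x * B₁ + B₁ + x * B₀ + B₀ ≡ suc x * (B₀ + B₁)
  collect = solve-∀

ℕtoℚ-suc-nonZero : ∀ r → ℚ.NonZero (ℕtoℚ (suc r))
ℕtoℚ-suc-nonZero r = subst ℚ.NonZero (sym (ℕtoℚ≡mkℚ (suc r))) _

solve-linear : ∀ s b c d .{{_ : ℚ.NonZero s}} → s ℚ.* b ℚ.+ c ≡ d → b ≡ ℚ.1/ s ℚ.* (d ℚ.+ ℚ.- c)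
solve-linear s b c d sb+c≡d = begin
  b                                    ≡⟨ ℚ.*-identityˡ b ⟨
  1ℚ ℚ.* b                             ≡⟨ cong (ℚ._* b) (ℚ.*-inverseˡ s) ⟨
  (ℚ.1/ s ℚ.* s) ℚ.* b                 ≡⟨ ℚ.*-assoc (ℚ.1/ s) s b ⟩
  ℚ.1/ s ℚ.* (s ℚ.* b)                 ≡⟨ cong (ℚ.1/ s ℚ.*_) (solve 2 (λ x c → x := x :+ c :- c) refl (s ℚ.* b) c) ⟩
  ℚ.1/ s ℚ.* (s ℚ.* b ℚ.+ c ℚ.+ ℚ.- c) ≡⟨ cong (λ t → ℚ.1/ s ℚ.* (t ℚ.+ ℚ.- c)) sb+c≡d ⟩
  ℚ.1/ s ℚ.* (d ℚ.+ ℚ.- c)             ∎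
  where open ≡-Reasoning

isPolynomial-C : (X : ℕ → ℕ) → IsPolynomial (ℕtoℚ ∘ X) → ∀ r → IsPolynomial (λ n → ℕtoℚ (X n C r))
isPolynomial-C X X-poly zero    = isPolynomial-const 1ℚ
isPolynomial-C X X-poly (suc r) =
  isPolynomial-cong recurrence
    (isPolynomial-* (isPolynomial-const (ℚ.1/ ℕtoℚ (suc r)))
                    (isPolynomial-+ (isPolynomial-* X-poly previous)
                                    (isPolynomial-* (isPolynomial-const (ℚ.- ℕtoℚ r)) previous)))
  where
  instance
    _ : ℚ.NonZero (ℕtoℚ (suc r))
    _ = ℕtoℚ-suc-nonZero r
  previous : IsPolynomial (λ n → ℕtoℚ (X n C r))
  previous = isPolynomial-C X X-poly r
  absorptionℚ : ∀ n → ℕtoℚ (suc r) ℚ.* ℕtoℚ (X n C suc r) ℚ.+ ℕtoℚ r ℚ.* ℕtoℚ (X n C r) ≡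
                      ℕtoℚ (X n) ℚ.* ℕtoℚ (X n C r)
  absorptionℚ n = begin
    ℕtoℚ (suc r) ℚ.* ℕtoℚ (X n C suc r) ℚ.+ ℕtoℚ r ℚ.* ℕtoℚ (X n C r)
      ≡⟨ cong₂ ℚ._+_ (ℕtoℚ-* (suc r) (X n C suc r)) (ℕtoℚ-* r (X n C r)) ⟨
    ℕtoℚ (suc r * (X n C suc r)) ℚ.+ ℕtoℚ (r * (X n C r))
      ≡⟨ ℕtoℚ-+ (suc r * (X n C suc r)) (r * (X n C r)) ⟨
    ℕtoℚ (suc r * (X n C suc r) + r * (X n C r))
      ≡⟨ cong ℕtoℚ (absorption (X n) r) ⟩
    ℕtoℚ (X n * (X n C r))
      ≡⟨ ℕtoℚ-* (X n) _ ⟩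
    ℕtoℚ (X n) ℚ.* ℕtoℚ (X n C r) ∎
    where open ≡-Reasoning
  recurrence : ∀ n → ℕtoℚ (X n C suc r) ≡
               ℚ.1/ ℕtoℚ (suc r) ℚ.* (ℕtoℚ (X n) ℚ.* ℕtoℚ (X n C r) ℚ.+ ℚ.- ℕtoℚ r ℚ.* ℕtoℚ (X n C r))
  recurrence n =
    trans (solve-linear (ℕtoℚ (suc r)) (ℕtoℚ (X n C suc r)) (ℕtoℚ r ℚ.* ℕtoℚ (X n C r))
                        (ℕtoℚ (X n) ℚ.* ℕtoℚ (X n C r)) (absorptionℚ n))
          (cong (λ t → ℚ.1/ ℕtoℚ (suc r) ℚ.* (ℕtoℚ (X n) ℚ.* ℕtoℚ (X n C r) ℚ.+ t))
                (ℚ.neg-distribˡ-* (ℕtoℚ r) (ℕtoℚ (X n C r))))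

isPolynomial-evalNewton : ∀ k (e : NewtonPoly k) (X : ℕ → Fin k → ℕ) →
                          (∀ i → IsPolynomial (λ n → ℕtoℚ (X n i))) →
                          IsPolynomial (λ n → ℕtoℚ (evalNewton k e (X n)))
isPolynomial-evalNewtonFrom : ∀ k (ps : List (NewtonPoly k)) r (X : ℕ → Fin (suc k) → ℕ) →
                              (∀ i → IsPolynomial (λ n → ℕtoℚ (X n i))) →
                              IsPolynomial (λ n → ℕtoℚ (evalNewtonFrom k ps r (X n zero) (X n ∘ suc)))
isPolynomial-evalNewton zero    c  X X-poly = isPolynomial-const (ℕtoℚ c)
isPolynomial-evalNewton (suc k) ps X X-poly = isPolynomial-evalNewtonFrom k ps 0 X X-poly
isPolynomial-evalNewtonFrom k []       r X X-poly = isPolynomial-const 0ℚ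
isPolynomial-evalNewtonFrom k (p ∷ ps) r X X-poly =
  isPolynomial-cong (λ n → let x = X n zero ; y = X n ∘ suc ; later = evalNewtonFrom k ps (suc r) x y in
                       trans (ℕtoℚ-+ ((x C r) * evalNewton k p y) later)
                             (cong (ℚ._+ ℕtoℚ later) (ℕtoℚ-* (x C r) (evalNewton k p y))))
    (isPolynomial-+ (isPolynomial-* (isPolynomial-C (λ n → X n zero) (X-poly zero) r)
                                    (isPolynomial-evalNewton k p (λ n → X n ∘ suc) (X-poly ∘ suc)))
                    (isPolynomial-evalNewtonFrom k ps (suc r) X X-poly))

corollary5p1 : (k ℓ : ℕ) (N : ℕ → Fin k → ℕ) → IsBasicSequence k N →
               (λs : Signature) (I : QFInterpretation λs (β k ℓ)) →
               StronglyPolynomial (λ n → interpret I (basic k ℓ (N n)))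
corollary5p1 k ℓ N (Q , _ , N≡Q) λs I p φ =
  isPolynomial-cong counts-agree (isPolynomial-evalNewton k e N (λ i → Q i , N≡Q i))
  where
  open BasicAsColoured k ℓ
  newton : Σ (NewtonPoly k) λ e → ∀ N → count (basic k ℓ N) (relativise I φ) ≡ evalNewton k e N
  newton = count-basic-newton (relativise I φ)
  e : NewtonPoly k
  e = proj₁ newton
  counts-agree : ∀ n → ℕtoℚ (count (interpret I (basic k ℓ (N n))) φ) ≡ ℕtoℚ (evalNewton k e (N n))
  counts-agree n = cong ℕtoℚ (trans (count-interpret I (basic k ℓ (N n)) (basic-extensional (N n)) φ)
                                    (proj₂ newton (N n)))
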